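{- Let $a,b,c,d\in\mathbb{Z}$ and $f(z)=z^5+az^3+bz^2+cz+d\in\mathbb{Z}[z]$, and assume that the elliptic curve $E_{a,b}: Y^2=X^3+135(2a-15)X-1350(5a+2b-26)$ has infinitely many rational points. Then the equation $x^2-y^3-f(z)=t$ has infinitely many solutions $(x,y,z)$ with $x,y,z$ in the polynomial ring $\mathbb{Q}[t]$.
   Context: Here $t$ is an indeterminate (transcendental over $\mathbb{Q}$). -}

module Defs where

open import Data.Nat using (ℕ; zero; suc)
open import Data.Integer as ℤ using (ℤ; +_)
open import Data.Rational as ℚ using (ℚ; 0ℚ; 1ℚ)
open import Data.List using (List; []; _∷_)
open import Data.List.Relation.Unary.All using (All)
open import Data.Product using (Σ; ∃; _×_; _,_)
open import Relation.Binary.PropositionalEquality using (_≡_)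
open import Relation.Nullary using (¬_)

ℤ→ℚ : ℤ → ℚ
ℤ→ℚ n = n ℚ./ 1

-- Univariate polynomials over ℚ in the indeterminate t:
-- coefficient lists, lowest degree first.  Equality of polynomials is
-- coefficientwise equality (so trailing zeros are irrelevant).

Poly : Set
Poly = List ℚ

coeff : Poly → ℕ → ℚ
coeff []       _       = 0ℚ
coeff (a ∷ p)  zero    = a
coeff (a ∷ p)  (suc n) = coeff p n

_≈ₚ_ : Poly → Poly → Set
p ≈ₚ q = ∀ n → coeff p n ≡ coeff q n

constₚ : ℚ → Poly
constₚ a = a ∷ []

tₚ : Poly
tₚ = 0ℚ ∷ 1ℚ ∷ []

_+ₚ_ : Poly → Poly → Poly
[]      +ₚ q       = q
(a ∷ p) +ₚ []      = a ∷ p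
(a ∷ p) +ₚ (b ∷ q) = (a ℚ.+ b) ∷ (p +ₚ q)

scaleₚ : ℚ → Poly → Poly
scaleₚ a []      = []
scaleₚ a (b ∷ p) = (a ℚ.* b) ∷ scaleₚ a p

-ₚ_ : Poly → Poly
-ₚ p = scaleₚ (ℚ.- 1ℚ) p

_-ₚ_ : Poly → Poly → Poly
p -ₚ q = p +ₚ (-ₚ q)

_*ₚ_ : Poly → Poly → Poly
[]      *ₚ q = []
(a ∷ p) *ₚ q = scaleₚ a q +ₚ (0ℚ ∷ (p *ₚ q))

infixl 6 _+ₚ_ _-ₚ_
infixl 7 _*ₚ_
infix 4 _≈ₚ_

fEval : ℤ → ℤ → ℤ → ℤ → Poly → Poly
fEval a b c d z =
  let z2 = z *ₚ z
      z3 = z2 *ₚ z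
      z5 = z3 *ₚ z2
  in  z5 +ₚ (scaleₚ (ℤ→ℚ a) z3 +ₚ (scaleₚ (ℤ→ℚ b) z2
         +ₚ (scaleₚ (ℤ→ℚ c) z +ₚ constₚ (ℤ→ℚ d))))

IsSolution : ℤ → ℤ → ℤ → ℤ → Poly × Poly × Poly → Set
IsSolution a b c d (x , y , z) =
  (((x *ₚ x) -ₚ ((y *ₚ y) *ₚ y)) -ₚ fEval a b c d z) ≈ₚ tₚ

_≈₃_ : Poly × Poly × Poly → Poly × Poly × Poly → Set
(x , y , z) ≈₃ (x' , y' , z') = (x ≈ₚ x') × (y ≈ₚ y') × (z ≈ₚ z')

OnE : ℤ → ℤ → ℚ × ℚ → Set
OnE a b (X , Y) =
  Y ℚ.* Y ≡ (X ℚ.* X ℚ.* X)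
            ℚ.+ ℤ→ℚ (+ 135 ℤ.* ((+ 2 ℤ.* a) ℤ.- + 15)) ℚ.* X
            ℚ.- ℤ→ℚ (+ 1350 ℤ.* (((+ 5 ℤ.* a) ℤ.+ (+ 2 ℤ.* b)) ℤ.- + 26))

-- "P has infinitely many elements" (w.r.t. an equality _~_):
-- no finite list exhausts P, witnessed explicitly.
InfinitelyMany : {A : Set} → (A → A → Set) → (A → Set) → Set
InfinitelyMany {A} _~_ P =
  (l : List A) → Σ A λ x → P x × All (λ y → ¬ (x ~ y)) l

-- Write y = Z² + uZ + v and x = P(Z) with P the monic cubic for which
-- P² − y³ − f(Z) has degree at most 2 in Z; its coefficients are then
-- rem₀ + rem₁ Z + rem₂ Z², and rem₂ = 0 is, after the change of variables
-- X = 15u + 30, Y = 30(β(u) − 3v/2), exactly the equation of E_{a,b}.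
-- For a rational point with rem₁ ≠ 0 the linear polynomial
-- Z = (t − rem₀)/rem₁ turns (x, y, Z) into a solution, and the point can
-- be read back off it.  Finally rem₁(X, Y) rem₁(X, −Y) agrees on the
-- curve with a nonzero polynomial of degree 8 in X, so all but finitely
-- many points P have rem₁(P) ≠ 0 or rem₁(−P) ≠ 0.
module Submission where

open import Defs
open import Data.Integer using (ℤ)
open import Relation.Binary.PropositionalEquality using (_≡_)

open import Agda.Builtin.FromNat using (Number; fromNat)
open import Agda.Builtin.FromNeg using (Negative; fromNeg)
open import Data.Empty using (⊥; ⊥-elim)
open import Data.Integer as ℤ using (-[1+_])
import Data.Integer.Literals as ℤLit
import Data.Integer.Properties as ℤ
open import Data.List using (List; []; _∷_; map; _++_; length; upTo)
open import Data.List.Properties using (length-map; length-upTo)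
open import Data.List.Relation.Unary.All as All using (All; []; _∷_)
import Data.List.Relation.Unary.All.Properties as All
open import Data.List.Relation.Unary.AllPairs using ([]; _∷_)
open import Data.List.Relation.Unary.Unique.Propositional using (Unique)
open import Data.List.Relation.Unary.Unique.Propositional.Properties
  using (upTo⁺) renaming (map⁺ to Unique-map⁺)
open import Data.Maybe using (Maybe; just; nothing)
open import Data.Nat as ℕ using (ℕ; zero; suc; s≤s)
import Data.Nat.Coprimality as ℕ
import Data.Nat.Literals as ℕLit
import Data.Nat.Properties as ℕ
open import Data.Product using (Σ; _×_; _,_; proj₁; proj₂)
open import Data.Rational as ℚ using (ℚ; 0ℚ; 1ℚ; _+_; _*_; _-_; -_; _/_)
import Data.Rational.Literals as ℚLit
import Data.Rational.Properties as ℚ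
open import Algebra.Properties.Group ℚ.+-0-group using () renaming (⁻¹-involutive to -‿involutive)
open import Data.Sum as Sum using (_⊎_; inj₁; inj₂)
open import Data.Unit using (tt)
open import Level using (0ℓ)
open import Relation.Binary.PropositionalEquality
  using (refl; sym; trans; cong; cong₂; _≢_; module ≡-Reasoning)
open import Relation.Nullary using (¬_; Dec; yes; no)
open import Relation.Unary using (Decidable)
open import Tactic.RingSolver using (solve-∀)
import Tactic.RingSolver.Core.AlmostCommutativeRing as ACR

open ≡-Reasoning

instance
  ℕ-number : Number ℕ
  ℕ-number = ℕLit.number

  ℤ-number : Number ℤ
  ℤ-number = ℤLit.number

  ℤ-negative : Negative ℤ
  ℤ-negative = ℤLit.negative

  ℚ-number : Number ℚ
  ℚ-number = ℚLit.number

ℚ-ring : ACR.AlmostCommutativeRing 0ℓ 0ℓ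
ℚ-ring = ACR.fromCommutativeRing ℚ.+-*-commutativeRing isZero
  where
  isZero : (x : ℚ) → Maybe (0ℚ ≡ x)
  isZero x with 0ℚ ℚ.≟ x
  ... | yes x≡0 = just x≡0
  ... | no  _   = nothing

-- The inverse, extended by inv 0 = 0.
inv : ℚ → ℚ
inv q with q ℚ.≟ 0ℚ
... | yes _   = 0ℚ
... | no  q≢0 = ℚ.1/_ q {{ℚ.≢-nonZero q≢0}}

*-inv : ∀ q → q ≢ 0ℚ → q * inv q ≡ 1ℚ
*-inv q q≢0 with q ℚ.≟ 0ℚ
... | yes q≡0  = ⊥-elim (q≢0 q≡0)
... | no  q≢0′ = ℚ.*-inverseʳ q {{ℚ.≢-nonZero q≢0′}}

inv-≢0 : ∀ q → q ≢ 0ℚ → inv q ≢ 0ℚ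
inv-≢0 q q≢0 inv≡0 = ℚ.1≢0 (begin
  1ℚ          ≡⟨ sym (*-inv q q≢0) ⟩
  q * inv q   ≡⟨ cong (q *_) inv≡0 ⟩
  q * 0ℚ      ≡⟨ ℚ.*-zeroʳ q ⟩
  0ℚ          ∎)

p*q≡0⇒p≡0∨q≡0 : ∀ p q → p * q ≡ 0ℚ → p ≡ 0ℚ ⊎ q ≡ 0ℚ
p*q≡0⇒p≡0∨q≡0 p q pq≡0 with p ℚ.≟ 0ℚ
... | yes p≡0 = inj₁ p≡0
... | no  p≢0 = inj₂ (begin
  q                 ≡⟨ sym (ℚ.*-identityˡ q) ⟩
  1ℚ * q            ≡⟨ cong (_* q) (sym (trans (ℚ.*-comm (inv p) p) (*-inv p p≢0))) ⟩
  inv p * p * q     ≡⟨ ℚ.*-assoc (inv p) p q ⟩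
  inv p * (p * q)   ≡⟨ cong (inv p *_) pq≡0 ⟩
  inv p * 0ℚ        ≡⟨ ℚ.*-zeroʳ (inv p) ⟩
  0ℚ                ∎)

factor≡0⇒≡0 : ∀ {d s w W : ℚ} → d ≡ (s - w) * W → s ≡ w → d ≡ 0ℚ
factor≡0⇒≡0 {d} {s} {w} {W} d≡ s≡w = begin
  d             ≡⟨ d≡ ⟩
  (s - w) * W   ≡⟨ cong (λ s′ → (s′ - w) * W) s≡w ⟩
  (w - w) * W   ≡⟨ cong (_* W) (ℚ.+-inverseʳ w) ⟩
  0ℚ * W        ≡⟨ ℚ.*-zeroˡ W ⟩
  0ℚ            ∎

p-q≡0⇒p≡q : ∀ p q → p - q ≡ 0ℚ → p ≡ q
p-q≡0⇒p≡q p q p-q≡0 = begin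
  p            ≡⟨ shift p q ⟩
  p - q + q    ≡⟨ cong (_+ q) p-q≡0 ⟩
  0ℚ + q       ≡⟨ ℚ.+-identityˡ q ⟩
  q            ∎
  where
  shift : ∀ p q → p ≡ p - q + q
  shift = solve-∀ ℚ-ring

p*p≡q*q⇒p≡q∨p≡-q : ∀ p q → p * p ≡ q * q → p ≡ q ⊎ p ≡ - q
p*p≡q*q⇒p≡q∨p≡-q p q pp≡qq =
  Sum.map (p-q≡0⇒p≡q p q)
          (λ p+q≡0 → p-q≡0⇒p≡q p (- q) (trans (cong (p +_) (-‿involutive q)) p+q≡0))
          (p*q≡0⇒p≡0∨q≡0 (p - q) (p + q) difference-of-squares)
  where
  factor : ∀ p q → (p - q) * (p + q) ≡ p * p - q * q
  factor = solve-∀ ℚ-ring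
  difference-of-squares : (p - q) * (p + q) ≡ 0ℚ
  difference-of-squares = begin
    (p - q) * (p + q)   ≡⟨ factor p q ⟩
    p * p - q * q       ≡⟨ cong (_- q * q) pp≡qq ⟩
    q * q - q * q       ≡⟨ ℚ.+-inverseʳ (q * q) ⟩
    0ℚ                  ∎

ℤ→ℚ≡fromℤ : ∀ n → ℤ→ℚ n ≡ ℚLit.fromℤ n
ℤ→ℚ≡fromℤ (ℤ.+ k)    = ℚ.normalize-coprime (ℕ.sym (ℕ.1-coprimeTo k))
ℤ→ℚ≡fromℤ -[1+ k ] = cong -_ (ℚ.normalize-coprime (ℕ.sym (ℕ.1-coprimeTo (suc k))))

ℤ→ℚ-homo-+ : ∀ m n → ℤ→ℚ (m ℤ.+ n) ≡ ℤ→ℚ m + ℤ→ℚ n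
ℤ→ℚ-homo-+ m n rewrite ℤ→ℚ≡fromℤ m | ℤ→ℚ≡fromℤ n =
  cong (_/ 1) (sym (cong₂ ℤ._+_ (ℤ.*-identityʳ m) (ℤ.*-identityʳ n)))

ℤ→ℚ-homo-* : ∀ m n → ℤ→ℚ (m ℤ.* n) ≡ ℤ→ℚ m * ℤ→ℚ n
ℤ→ℚ-homo-* m n rewrite ℤ→ℚ≡fromℤ m | ℤ→ℚ≡fromℤ n = refl

ℤ→ℚ-homo-‿- : ∀ n → ℤ→ℚ (ℤ.- n) ≡ - ℤ→ℚ n
ℤ→ℚ-homo-‿- n rewrite ℤ→ℚ≡fromℤ (ℤ.- n) | ℤ→ℚ≡fromℤ n = fromℤ-neg n
  where
  fromℤ-neg : ∀ n → ℚLit.fromℤ (ℤ.- n) ≡ - ℚLit.fromℤ n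
  fromℤ-neg (ℤ.+ zero)  = refl
  fromℤ-neg (ℤ.+ suc k) = refl
  fromℤ-neg -[1+ k ]  = refl

ℤ→ℚ-homo-- : ∀ m n → ℤ→ℚ (m ℤ.- n) ≡ ℤ→ℚ m - ℤ→ℚ n
ℤ→ℚ-homo-- m n = trans (ℤ→ℚ-homo-+ m (ℤ.- n)) (cong (ℤ→ℚ m +_) (ℤ→ℚ-homo-‿- n))

evalₚ : Poly → ℚ → ℚ
evalₚ []      x = 0ℚ
evalₚ (c ∷ p) x = c + x * evalₚ p x

evalₚ-+ₚ : ∀ p q x → evalₚ (p +ₚ q) x ≡ evalₚ p x + evalₚ q x
evalₚ-+ₚ []      q       x = sym (ℚ.+-identityˡ (evalₚ q x))
evalₚ-+ₚ (a ∷ p) []      x = sym (ℚ.+-identityʳ (evalₚ (a ∷ p) x))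
evalₚ-+ₚ (a ∷ p) (b ∷ q) x = begin
  a + b + x * evalₚ (p +ₚ q) x           ≡⟨ cong (λ s → a + b + x * s) (evalₚ-+ₚ p q x) ⟩
  a + b + x * (evalₚ p x + evalₚ q x)     ≡⟨ regroup a b x (evalₚ p x) (evalₚ q x) ⟩
  a + x * evalₚ p x + (b + x * evalₚ q x) ∎
  where
  regroup : ∀ a b x s t → a + b + x * (s + t) ≡ a + x * s + (b + x * t)
  regroup = solve-∀ ℚ-ring

evalₚ-scaleₚ : ∀ a p x → evalₚ (scaleₚ a p) x ≡ a * evalₚ p x
evalₚ-scaleₚ a []      x = sym (ℚ.*-zeroʳ a)
evalₚ-scaleₚ a (b ∷ p) x = begin
  a * b + x * evalₚ (scaleₚ a p) x ≡⟨ cong (λ s → a * b + x * s) (evalₚ-scaleₚ a p x) ⟩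
  a * b + x * (a * evalₚ p x)      ≡⟨ regroup a b x (evalₚ p x) ⟩
  a * (b + x * evalₚ p x)          ∎
  where
  regroup : ∀ a b x s → a * b + x * (a * s) ≡ a * (b + x * s)
  regroup = solve-∀ ℚ-ring

evalₚ--ₚ : ∀ p q x → evalₚ (p -ₚ q) x ≡ evalₚ p x - evalₚ q x
evalₚ--ₚ p q x = begin
  evalₚ (p +ₚ scaleₚ (- 1ℚ) q) x        ≡⟨ evalₚ-+ₚ p (scaleₚ (- 1ℚ) q) x ⟩
  evalₚ p x + evalₚ (scaleₚ (- 1ℚ) q) x ≡⟨ cong (evalₚ p x +_) (evalₚ-scaleₚ (- 1ℚ) q x) ⟩
  evalₚ p x + - 1ℚ * evalₚ q x          ≡⟨ regroup (evalₚ p x) (evalₚ q x) ⟩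
  evalₚ p x - evalₚ q x                 ∎
  where
  regroup : ∀ s t → s + - 1ℚ * t ≡ s - t
  regroup = solve-∀ ℚ-ring

evalₚ-*ₚ : ∀ p q x → evalₚ (p *ₚ q) x ≡ evalₚ p x * evalₚ q x
evalₚ-*ₚ []      q x = sym (ℚ.*-zeroˡ (evalₚ q x))
evalₚ-*ₚ (a ∷ p) q x = begin
  evalₚ (scaleₚ a q +ₚ (0ℚ ∷ p *ₚ q)) x
    ≡⟨ evalₚ-+ₚ (scaleₚ a q) (0ℚ ∷ p *ₚ q) x ⟩
  evalₚ (scaleₚ a q) x + (0ℚ + x * evalₚ (p *ₚ q) x)
    ≡⟨ cong₂ (λ s s′ → s + (0ℚ + x * s′)) (evalₚ-scaleₚ a q x) (evalₚ-*ₚ p q x) ⟩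
  a * evalₚ q x + (0ℚ + x * (evalₚ p x * evalₚ q x)) ≡⟨ regroup a x (evalₚ p x) (evalₚ q x) ⟩
  (a + x * evalₚ p x) * evalₚ q x                     ∎
  where
  regroup : ∀ a x s t → a * t + (0ℚ + x * (s * t)) ≡ (a + x * s) * t
  regroup = solve-∀ ℚ-ring

infixl 8 _∘ₚ_

_∘ₚ_ : Poly → Poly → Poly
[]      ∘ₚ z = []
(c ∷ p) ∘ₚ z = constₚ c +ₚ z *ₚ (p ∘ₚ z)

evalₚ-∘ₚ : ∀ p z x → evalₚ (p ∘ₚ z) x ≡ evalₚ p (evalₚ z x)
evalₚ-∘ₚ []      z x = refl
evalₚ-∘ₚ (c ∷ p) z x = begin
  evalₚ (constₚ c +ₚ z *ₚ (p ∘ₚ z)) x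
    ≡⟨ evalₚ-+ₚ (constₚ c) (z *ₚ (p ∘ₚ z)) x ⟩
  c + x * 0ℚ + evalₚ (z *ₚ (p ∘ₚ z)) x
    ≡⟨ cong₂ _+_ (drop-zero c x) (evalₚ-*ₚ z (p ∘ₚ z) x) ⟩
  c + evalₚ z x * evalₚ (p ∘ₚ z) x
    ≡⟨ cong (λ s → c + evalₚ z x * s) (evalₚ-∘ₚ p z x) ⟩
  c + evalₚ z x * evalₚ p (evalₚ z x) ∎
  where
  drop-zero : ∀ c x → c + x * 0ℚ ≡ c
  drop-zero = solve-∀ ℚ-ring

-- A polynomial with more distinct roots than coefficients is zero

coeff-+ₚ : ∀ p q n → coeff (p +ₚ q) n ≡ coeff p n + coeff q n
coeff-+ₚ []      q       n       = sym (ℚ.+-identityˡ (coeff q n))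
coeff-+ₚ (a ∷ p) []      n       = sym (ℚ.+-identityʳ (coeff (a ∷ p) n))
coeff-+ₚ (a ∷ p) (b ∷ q) zero    = refl
coeff-+ₚ (a ∷ p) (b ∷ q) (suc n) = coeff-+ₚ p q n

coeff-scaleₚ : ∀ a p n → coeff (scaleₚ a p) n ≡ a * coeff p n
coeff-scaleₚ a []      n       = sym (ℚ.*-zeroʳ a)
coeff-scaleₚ a (b ∷ p) zero    = refl
coeff-scaleₚ a (b ∷ p) (suc n) = coeff-scaleₚ a p n

coeff--ₚ : ∀ p q n → coeff (p -ₚ q) n ≡ coeff p n - coeff q n
coeff--ₚ p q n = begin
  coeff (p +ₚ scaleₚ (- 1ℚ) q) n        ≡⟨ coeff-+ₚ p (scaleₚ (- 1ℚ) q) n ⟩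
  coeff p n + coeff (scaleₚ (- 1ℚ) q) n ≡⟨ cong (coeff p n +_) (coeff-scaleₚ (- 1ℚ) q n) ⟩
  coeff p n + - 1ℚ * coeff q n          ≡⟨ regroup (coeff p n) (coeff q n) ⟩
  coeff p n - coeff q n                 ∎
  where
  regroup : ∀ s t → s + - 1ℚ * t ≡ s - t
  regroup = solve-∀ ℚ-ring

-- Synthetic division by x − r.
quotient : ℚ → Poly → Poly
quotient r []          = []
quotient r (c ∷ [])    = []
quotient r (c ∷ d ∷ p) = evalₚ (d ∷ p) r ∷ quotient r (d ∷ p)

length-quotient : ∀ r c p → length (quotient r (c ∷ p)) ≡ length p
length-quotient r c []      = refl
length-quotient r c (d ∷ p) = cong suc (length-quotient r d p)

factor-theorem : ∀ r x p → evalₚ p x - evalₚ p r ≡ (x - r) * evalₚ (quotient r p) x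
factor-theorem r x []          = constant x r
  where
  constant : ∀ x r → 0ℚ - 0ℚ ≡ (x - r) * 0ℚ
  constant = solve-∀ ℚ-ring
factor-theorem r x (c ∷ [])    = constant c x r
  where
  constant : ∀ c x r → c + x * 0ℚ - (c + r * 0ℚ) ≡ (x - r) * 0ℚ
  constant = solve-∀ ℚ-ring
factor-theorem r x (c ∷ d ∷ p) = begin
  c + x * evalₚ (d ∷ p) x - (c + r * evalₚ (d ∷ p) r)
    ≡⟨ regroup c x r (evalₚ (d ∷ p) x) (evalₚ (d ∷ p) r) ⟩
  (x - r) * evalₚ (d ∷ p) r + x * (evalₚ (d ∷ p) x - evalₚ (d ∷ p) r)
    ≡⟨ cong (λ s → (x - r) * evalₚ (d ∷ p) r + x * s) (factor-theorem r x (d ∷ p)) ⟩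
  (x - r) * evalₚ (d ∷ p) r + x * ((x - r) * evalₚ (quotient r (d ∷ p)) x)
    ≡⟨ regroup′ x r (evalₚ (d ∷ p) r) (evalₚ (quotient r (d ∷ p)) x) ⟩
  (x - r) * (evalₚ (d ∷ p) r + x * evalₚ (quotient r (d ∷ p)) x) ∎
  where
  regroup : ∀ c x r s s′ → c + x * s - (c + r * s′) ≡ (x - r) * s′ + x * (s - s′)
  regroup = solve-∀ ℚ-ring
  regroup′ : ∀ x r s t → (x - r) * s + x * ((x - r) * t) ≡ (x - r) * (s + x * t)
  regroup′ = solve-∀ ℚ-ring

-- Coefficientwise, c ∷ p = (x − r) · quotient r (c ∷ p) + p(r).
coeff-quotient-zero : ∀ r c p → coeff (c ∷ p) 0 ≡ evalₚ (c ∷ p) r - r * coeff (quotient r (c ∷ p)) 0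
coeff-quotient-zero r c []      = cancel c r
  where
  cancel : ∀ c r → c ≡ c + r * 0ℚ - r * 0ℚ
  cancel = solve-∀ ℚ-ring
coeff-quotient-zero r c (d ∷ p) = cancel c r (evalₚ (d ∷ p) r)
  where
  cancel : ∀ c r s → c ≡ c + r * s - r * s
  cancel = solve-∀ ℚ-ring

coeff-quotient-suc : ∀ r c p n →
  coeff (c ∷ p) (suc n) ≡ coeff (quotient r (c ∷ p)) n - r * coeff (quotient r (c ∷ p)) (suc n)
coeff-quotient-suc r c []      n       = zero-eq r
  where
  zero-eq : ∀ r → 0ℚ ≡ 0ℚ - r * 0ℚ
  zero-eq = solve-∀ ℚ-ring
coeff-quotient-suc r c (d ∷ p) zero    = coeff-quotient-zero r d p
coeff-quotient-suc r c (d ∷ p) (suc n) = coeff-quotient-suc r d p n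

quotient-roots : ∀ p r xs → evalₚ p r ≡ 0ℚ → All (r ≢_) xs →
  All (λ x → evalₚ p x ≡ 0ℚ) xs → All (λ x → evalₚ (quotient r p) x ≡ 0ℚ) xs
quotient-roots p r []       pr≡0 []           []           = []
quotient-roots p r (x ∷ xs) pr≡0 (r≢x ∷ r≢xs) (px≡0 ∷ pxs) =
  root-of-quotient ∷ quotient-roots p r xs pr≡0 r≢xs pxs
  where
  product≡0 : (x - r) * evalₚ (quotient r p) x ≡ 0ℚ
  product≡0 = begin
    (x - r) * evalₚ (quotient r p) x ≡⟨ sym (factor-theorem r x p) ⟩
    evalₚ p x - evalₚ p r             ≡⟨ cong₂ _-_ px≡0 pr≡0 ⟩
    0ℚ - 0ℚ                           ≡⟨ ℚ.+-inverseʳ 0ℚ ⟩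
    0ℚ                                ∎
  root-of-quotient : evalₚ (quotient r p) x ≡ 0ℚ
  root-of-quotient with p*q≡0⇒p≡0∨q≡0 (x - r) (evalₚ (quotient r p) x) product≡0
  ... | inj₁ x-r≡0 = ⊥-elim (r≢x (sym (p-q≡0⇒p≡q x r x-r≡0)))
  ... | inj₂ q≡0   = q≡0

roots⇒coeff≡0 : ∀ p xs → length p ℕ.≤ length xs → Unique xs →
  All (λ x → evalₚ p x ≡ 0ℚ) xs → ∀ n → coeff p n ≡ 0ℚ
roots⇒coeff≡0 []      xs       _              _                  _              n = refl
roots⇒coeff≡0 (c ∷ p) (r ∷ rs) (s≤s |p|≤|rs|) (r∉rs ∷ rs-unique) (pr≡0 ∷ prs≡0) n = coeff≡0 n
  where
  q : Poly
  q = quotient r (c ∷ p)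
  q≡0 : ∀ n → coeff q n ≡ 0ℚ
  q≡0 = roots⇒coeff≡0 q rs (ℕ.≤-trans (ℕ.≤-reflexive (length-quotient r c p)) |p|≤|rs|) rs-unique
          (quotient-roots (c ∷ p) r rs pr≡0 r∉rs prs≡0)
  zero-eq : ∀ r → 0ℚ - r * 0ℚ ≡ 0ℚ
  zero-eq = solve-∀ ℚ-ring
  coeff≡0 : ∀ n → coeff (c ∷ p) n ≡ 0ℚ
  coeff≡0 zero    = begin
    coeff (c ∷ p) 0                       ≡⟨ coeff-quotient-zero r c p ⟩
    evalₚ (c ∷ p) r - r * coeff q 0       ≡⟨ cong₂ (λ s s′ → s - r * s′) pr≡0 (q≡0 0) ⟩
    0ℚ - r * 0ℚ                           ≡⟨ zero-eq r ⟩
    0ℚ                                    ∎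
  coeff≡0 (suc n) = begin
    coeff (c ∷ p) (suc n)                 ≡⟨ coeff-quotient-suc r c p n ⟩
    coeff q n - r * coeff q (suc n)       ≡⟨ cong₂ (λ s s′ → s - r * s′) (q≡0 n) (q≡0 (suc n)) ⟩
    0ℚ - r * 0ℚ                           ≡⟨ zero-eq r ⟩
    0ℚ                                    ∎

naturals : ℕ → List ℚ
naturals n = map (λ k → ℚLit.fromℤ (ℤ.+ k)) (upTo n)

naturals-unique : ∀ n → Unique (naturals n)
naturals-unique n = Unique-map⁺ (λ eq → ℤ.+-injective (cong ℚ.↥_ eq)) (upTo⁺ n)

length-naturals : ∀ n → length (naturals n) ≡ n
length-naturals n = trans (length-map _ (upTo n)) (length-upTo n)

evalₚ-injective : ∀ p q → (∀ x → evalₚ p x ≡ evalₚ q x) → p ≈ₚ q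
evalₚ-injective p q p≗q n = p-q≡0⇒p≡q (coeff p n) (coeff q n) (begin
  coeff p n - coeff q n ≡⟨ sym (coeff--ₚ p q n) ⟩
  coeff (p -ₚ q) n      ≡⟨ roots⇒coeff≡0 (p -ₚ q) (naturals L)
                             (ℕ.≤-reflexive (sym (length-naturals L))) (naturals-unique L)
                             (All.tabulate λ {x} _ → vanishes x) n ⟩
  0ℚ                    ∎)
  where
  L : ℕ
  L = length (p -ₚ q)
  vanishes : ∀ x → evalₚ (p -ₚ q) x ≡ 0ℚ
  vanishes x = begin
    evalₚ (p -ₚ q) x      ≡⟨ evalₚ--ₚ p q x ⟩
    evalₚ p x - evalₚ q x ≡⟨ cong (_- evalₚ q x) (p≗q x) ⟩
    evalₚ q x - evalₚ q x ≡⟨ ℚ.+-inverseʳ (evalₚ q x) ⟩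
    0ℚ                    ∎

Point : Set
Point = ℚ × ℚ

OnCurve : (ℚ → ℚ) → Point → Set
OnCurve g (X , Y) = Y * Y ≡ g X

neg : Point → Point
neg (X , Y) = (X , - Y)

neg-involutive : ∀ P → neg (neg P) ≡ P
neg-involutive (X , Y) = cong (X ,_) (-‿involutive Y)

OnCurve-neg : ∀ g P → OnCurve g P → OnCurve g (neg P)
OnCurve-neg g (X , Y) onP = trans (neg-square Y) onP
  where
  neg-square : ∀ y → - y * - y ≡ y * y
  neg-square = solve-∀ ℚ-ring

same-x⇒≡∨≡neg : ∀ g P Q → OnCurve g P → OnCurve g Q → proj₁ P ≡ proj₁ Q →
  P ≡ Q ⊎ P ≡ neg Q
same-x⇒≡∨≡neg g (X , Y) (X′ , Y′) onP onQ X≡X′ =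
  Sum.map (cong₂ _,_ X≡X′) (cong₂ _,_ X≡X′)
          (p*p≡q*q⇒p≡q∨p≡-q Y Y′ (trans onP (trans (cong g X≡X′) (sym onQ))))

module Avoiding (g : ℚ → ℚ) (infinite : InfinitelyMany _≡_ (OnCurve g))
                (R : ℚ → Set) (R? : Decidable R) (k : ℕ)
                (few : ∀ xs → length xs ≡ k → Unique xs → All R xs → ⊥)
                (excluded : List Point) where

  Wanted : Set
  Wanted = Σ Point λ P → OnCurve g P × ¬ R (proj₁ P) × All (P ≢_) excluded

  BadPoint : Point → Set
  BadPoint P = OnCurve g P × R (proj₁ P)

  new-x : ∀ P Qs → OnCurve g P → All BadPoint Qs → All (P ≢_) Qs → All (P ≢_) (map neg Qs) →
    All (proj₁ P ≢_) (map proj₁ Qs)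
  new-x P []       onP []                  []          []            = []
  new-x P (Q ∷ Qs) onP ((onQ , _) ∷ bads) (P≢Q ∷ P∉Qs) (P≢-Q ∷ P∉-Qs) =
    x≢ ∷ new-x P Qs onP bads P∉Qs P∉-Qs
    where
    x≢ : proj₁ P ≢ proj₁ Q
    x≢ xP≡xQ = Sum.[ P≢Q , P≢-Q ] (same-x⇒≡∨≡neg g P Q onP onQ xP≡xQ)

  -- Keep drawing points outside excluded ++ Qs ++ −Qs; bad ones have new
  -- x-coordinates, so at most k − 1 of them can be drawn.
  search : (m : ℕ) (Qs : List Point) → length Qs ℕ.+ m ≡ k → All BadPoint Qs →
    Unique (map proj₁ Qs) → Wanted
  search zero Qs |Qs|≡k bads unique = ⊥-elim (few (map proj₁ Qs)
    (trans (length-map proj₁ Qs) (trans (sym (ℕ.+-identityʳ (length Qs))) |Qs|≡k))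
    unique (All.map⁺ (All.map proj₂ bads)))
  search (suc m) Qs |Qs|≡k bads unique with infinite (excluded ++ (Qs ++ map neg Qs))
  ... | P , onP , P∉ with All.++⁻ excluded P∉
  ...   | P∉excluded , P∉Qs±  with R? (proj₁ P)
  ...     | no ¬RP = P , onP , ¬RP , P∉excluded
  ...     | yes RP = search m (P ∷ Qs) (trans (sym (ℕ.+-suc (length Qs) m)) |Qs|≡k)
                        ((onP , RP) ∷ bads)
                        (new-x P Qs onP bads (All.++⁻ˡ Qs P∉Qs±) (All.++⁻ʳ Qs P∉Qs±) ∷ unique)

  avoiding : Wanted
  avoiding = search k [] refl [] []

-- Completing the square of y³ + f(z)

fℚ : ℚ → ℚ → ℚ → ℚ → Poly → Poly
fℚ A B C D z =
  let z2 = z *ₚ z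
      z3 = z2 *ₚ z
      z5 = z3 *ₚ z2
  in  z5 +ₚ (scaleₚ A z3 +ₚ (scaleₚ B z2 +ₚ (scaleₚ C z +ₚ constₚ D)))

residual : ℚ → ℚ → ℚ → ℚ → Poly × Poly × Poly → Poly
residual A B C D (x , y , z) = ((x *ₚ x) -ₚ ((y *ₚ y) *ₚ y)) -ₚ fℚ A B C D z

residual≈t⇒IsSolution : ∀ a b c d x y z →
  residual (ℤ→ℚ a) (ℤ→ℚ b) (ℤ→ℚ c) (ℤ→ℚ d) (x , y , z) ≈ₚ tₚ →
  IsSolution a b c d (x , y , z)
residual≈t⇒IsSolution a b c d x y z residual≈t = residual≈t

quintic : ℚ → ℚ → ℚ → ℚ → ℚ → ℚ
quintic A B C D Z = Z * Z * Z * (Z * Z) + (A * (Z * Z * Z) + (B * (Z * Z) + (C * Z + D)))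

residualℚ : ℚ → ℚ → ℚ → ℚ → ℚ → ℚ → ℚ → ℚ
residualℚ A B C D X Y Z = X * X - Y * Y * Y - quintic A B C D Z

evalₚ-fℚ : ∀ A B C D z t → evalₚ (fℚ A B C D z) t ≡ quintic A B C D (evalₚ z t)
evalₚ-fℚ A B C D z t =
  trans (evalₚ-+ₚ z5 _ t) (cong₂ _+_ Z⁵
  (trans (evalₚ-+ₚ (scaleₚ A z3) _ t) (cong₂ _+_ (scaled A z3 Z³)
  (trans (evalₚ-+ₚ (scaleₚ B z2) _ t) (cong₂ _+_ (scaled B z2 Z²)
  (trans (evalₚ-+ₚ (scaleₚ C z) (constₚ D) t) (cong₂ _+_ (evalₚ-scaleₚ C z t) constant)))))))
  where
  Z : ℚ
  Z = evalₚ z t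
  z2 z3 z5 : Poly
  z2 = z *ₚ z
  z3 = z2 *ₚ z
  z5 = z3 *ₚ z2
  Z² : evalₚ z2 t ≡ Z * Z
  Z² = evalₚ-*ₚ z z t
  Z³ : evalₚ z3 t ≡ Z * Z * Z
  Z³ = trans (evalₚ-*ₚ z2 z t) (cong (_* Z) Z²)
  Z⁵ : evalₚ z5 t ≡ Z * Z * Z * (Z * Z)
  Z⁵ = trans (evalₚ-*ₚ z3 z2 t) (cong₂ _*_ Z³ Z²)
  scaled : ∀ a p {P} → evalₚ p t ≡ P → evalₚ (scaleₚ a p) t ≡ a * P
  scaled a p p≡P = trans (evalₚ-scaleₚ a p t) (cong (a *_) p≡P)
  constant : evalₚ (constₚ D) t ≡ D
  constant = trans (cong (D +_) (ℚ.*-zeroʳ t)) (ℚ.+-identityʳ D)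

evalₚ-residual : ∀ A B C D x y z t →
  evalₚ (residual A B C D (x , y , z)) t ≡ residualℚ A B C D (evalₚ x t) (evalₚ y t) (evalₚ z t)
evalₚ-residual A B C D x y z t = begin
  evalₚ (((x *ₚ x) -ₚ ((y *ₚ y) *ₚ y)) -ₚ fℚ A B C D z) t
    ≡⟨ evalₚ--ₚ ((x *ₚ x) -ₚ ((y *ₚ y) *ₚ y)) (fℚ A B C D z) t ⟩
  evalₚ ((x *ₚ x) -ₚ ((y *ₚ y) *ₚ y)) t - evalₚ (fℚ A B C D z) t
    ≡⟨ cong₂ _-_ (evalₚ--ₚ (x *ₚ x) ((y *ₚ y) *ₚ y) t) (evalₚ-fℚ A B C D z t) ⟩
  evalₚ (x *ₚ x) t - evalₚ ((y *ₚ y) *ₚ y) t - quintic A B C D (evalₚ z t)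
    ≡⟨ cong₂ (λ s s′ → s - s′ - quintic A B C D (evalₚ z t))
             (evalₚ-*ₚ x x t) (trans (evalₚ-*ₚ (y *ₚ y) y t) (cong (_* evalₚ y t) (evalₚ-*ₚ y y t))) ⟩
  residualℚ A B C D (evalₚ x t) (evalₚ y t) (evalₚ z t) ∎

monicQuadratic : ℚ → ℚ → Poly
monicQuadratic u v = v ∷ u ∷ 1ℚ ∷ []

sqrt₂ : ℚ → ℚ
sqrt₂ u = 1 / 2 * (1 + 3 * u)

sqrt₁ : ℚ → ℚ → ℚ
sqrt₁ u v = 1 / 2 * (3 * v + 3 * u * u - sqrt₂ u * sqrt₂ u)

sqrt₀ : ℚ → ℚ → ℚ → ℚ
sqrt₀ A u v = 1 / 2 * (A + u * u * u + 6 * u * v - 2 * sqrt₂ u * sqrt₁ u v)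

-- The coefficients are solved for one at a time from those of Z⁵, Z⁴, Z³.
approxSqrt : ℚ → ℚ → ℚ → Poly
approxSqrt A u v = sqrt₀ A u v ∷ sqrt₁ u v ∷ sqrt₂ u ∷ 1ℚ ∷ []

rem₂ : ℚ → ℚ → ℚ → ℚ → ℚ
rem₂ A B u v = sqrt₁ u v * sqrt₁ u v + 2 * sqrt₂ u * sqrt₀ A u v - 3 * u * u * v - 3 * v * v - B

rem₁ : ℚ → ℚ → ℚ → ℚ → ℚ
rem₁ A C u v = 2 * sqrt₁ u v * sqrt₀ A u v - 3 * u * v * v - C

rem₀ : ℚ → ℚ → ℚ → ℚ → ℚ
rem₀ A D u v = sqrt₀ A u v * sqrt₀ A u v - v * v * v - D

-- solve-∀ does not unfold definitions, so here and below such identities are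
-- spelled out in the form to which the statement computes.
residualℚ-approxSqrt : ∀ A B C D u v Z →
  residualℚ A B C D (evalₚ (approxSqrt A u v) Z) (evalₚ (monicQuadratic u v) Z) Z
    ≡ rem₀ A D u v + Z * (rem₁ A C u v + Z * rem₂ A B u v)
residualℚ-approxSqrt = expansion
  where
  expansion : ∀ A B C D u v Z →
    let x₂ = 1 / 2 * (1 + 3 * u)
        x₁ = 1 / 2 * (3 * v + 3 * u * u - x₂ * x₂)
        x₀ = 1 / 2 * (A + u * u * u + 6 * u * v - 2 * x₂ * x₁)
        X  = x₀ + Z * (x₁ + Z * (x₂ + Z * (1ℚ + Z * 0ℚ)))
        Y  = v + Z * (u + Z * (1ℚ + Z * 0ℚ))
    in  X * X - Y * Y * Y - (Z * Z * Z * (Z * Z) + (A * (Z * Z * Z) + (B * (Z * Z) + (C * Z + D))))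
        ≡ (x₀ * x₀ - v * v * v - D)
          + Z * ((2 * x₁ * x₀ - 3 * u * v * v - C)
          + Z * (x₁ * x₁ + 2 * x₂ * x₀ - 3 * u * u * v - 3 * v * v - B))
  expansion = solve-∀ ℚ-ring

linear : ℚ → ℚ → Poly
linear γ δ = δ ∷ γ ∷ []

curveSolution : ℚ → ℚ → ℚ → ℚ → ℚ → Poly × Poly × Poly
curveSolution A u v γ δ =
  approxSqrt A u v ∘ₚ linear γ δ , monicQuadratic u v ∘ₚ linear γ δ , linear γ δ

residual-curveSolution : ∀ A B C D u v γ δ → rem₂ A B u v ≡ 0ℚ →
  rem₁ A C u v * γ ≡ 1ℚ → rem₀ A D u v + rem₁ A C u v * δ ≡ 0ℚ →
  residual A B C D (curveSolution A u v γ δ) ≈ₚ tₚ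
residual-curveSolution A B C D u v γ δ r₂≡0 r₁γ≡1 r₀+r₁δ≡0 =
  evalₚ-injective (residual A B C D (x , y , z)) tₚ values
  where
  x y z : Poly
  x = approxSqrt A u v ∘ₚ z
  y = monicQuadratic u v ∘ₚ z
  z = linear γ δ
  r₀ r₁ : ℚ
  r₀ = rem₀ A D u v
  r₁ = rem₁ A C u v
  affine : ∀ r₀ r₁ γ δ t → let Z = δ + t * (γ + t * 0ℚ) in
    r₀ + Z * (r₁ + Z * 0ℚ) ≡ r₀ + r₁ * δ + t * (r₁ * γ)
  affine = solve-∀ ℚ-ring
  identity-t : ∀ t → 0ℚ + t * 1ℚ ≡ 0ℚ + t * (1ℚ + t * 0ℚ)
  identity-t = solve-∀ ℚ-ring
  values : ∀ t → evalₚ (residual A B C D (x , y , z)) t ≡ evalₚ tₚ t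
  values t = begin
    evalₚ (residual A B C D (x , y , z)) t
      ≡⟨ evalₚ-residual A B C D x y z t ⟩
    residualℚ A B C D (evalₚ x t) (evalₚ y t) Z
      ≡⟨ cong₂ (λ X Y → residualℚ A B C D X Y Z)
               (evalₚ-∘ₚ (approxSqrt A u v) z t) (evalₚ-∘ₚ (monicQuadratic u v) z t) ⟩
    residualℚ A B C D (evalₚ (approxSqrt A u v) Z) (evalₚ (monicQuadratic u v) Z) Z
      ≡⟨ residualℚ-approxSqrt A B C D u v Z ⟩
    r₀ + Z * (r₁ + Z * rem₂ A B u v)
      ≡⟨ cong (λ r₂ → r₀ + Z * (r₁ + Z * r₂)) r₂≡0 ⟩
    r₀ + Z * (r₁ + Z * 0ℚ)
      ≡⟨ affine r₀ r₁ γ δ t ⟩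
    r₀ + r₁ * δ + t * (r₁ * γ)
      ≡⟨ cong₂ (λ s s′ → s + t * s′) r₀+r₁δ≡0 r₁γ≡1 ⟩
    0ℚ + t * 1ℚ
      ≡⟨ identity-t t ⟩
    evalₚ tₚ t ∎
    where
    Z : ℚ
    Z = evalₚ z t

-- From points of the elliptic curve to solutions and back

weierstrass : ℚ → ℚ → ℚ → ℚ
weierstrass A B X = X * X * X + 135 * (2 * A - 15) * X - 1350 * (5 * A + 2 * B - 26)

weierstrass-linear-coeff : ∀ a →
  ℤ→ℚ (ℤ.+ 135 ℤ.* ((ℤ.+ 2 ℤ.* a) ℤ.- ℤ.+ 15)) ≡ 135 * (2 * ℤ→ℚ a - 15)
weierstrass-linear-coeff a = begin
  ℤ→ℚ (ℤ.+ 135 ℤ.* ((ℤ.+ 2 ℤ.* a) ℤ.- ℤ.+ 15))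
    ≡⟨ ℤ→ℚ-homo-* (ℤ.+ 135) ((ℤ.+ 2 ℤ.* a) ℤ.- ℤ.+ 15) ⟩
  135 * ℤ→ℚ ((ℤ.+ 2 ℤ.* a) ℤ.- ℤ.+ 15)
    ≡⟨ cong (135 *_) (ℤ→ℚ-homo-- (ℤ.+ 2 ℤ.* a) (ℤ.+ 15)) ⟩
  135 * (ℤ→ℚ (ℤ.+ 2 ℤ.* a) - 15)
    ≡⟨ cong (λ s → 135 * (s - 15)) (ℤ→ℚ-homo-* (ℤ.+ 2) a) ⟩
  135 * (2 * ℤ→ℚ a - 15) ∎

weierstrass-constant-coeff : ∀ a b →
  ℤ→ℚ (ℤ.+ 1350 ℤ.* (((ℤ.+ 5 ℤ.* a) ℤ.+ (ℤ.+ 2 ℤ.* b)) ℤ.- ℤ.+ 26))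
    ≡ 1350 * (5 * ℤ→ℚ a + 2 * ℤ→ℚ b - 26)
weierstrass-constant-coeff a b = begin
  ℤ→ℚ (ℤ.+ 1350 ℤ.* (((ℤ.+ 5 ℤ.* a) ℤ.+ (ℤ.+ 2 ℤ.* b)) ℤ.- ℤ.+ 26))
    ≡⟨ ℤ→ℚ-homo-* (ℤ.+ 1350) (((ℤ.+ 5 ℤ.* a) ℤ.+ (ℤ.+ 2 ℤ.* b)) ℤ.- ℤ.+ 26) ⟩
  1350 * ℤ→ℚ (((ℤ.+ 5 ℤ.* a) ℤ.+ (ℤ.+ 2 ℤ.* b)) ℤ.- ℤ.+ 26)
    ≡⟨ cong (1350 *_) (ℤ→ℚ-homo-- ((ℤ.+ 5 ℤ.* a) ℤ.+ (ℤ.+ 2 ℤ.* b)) (ℤ.+ 26)) ⟩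
  1350 * (ℤ→ℚ ((ℤ.+ 5 ℤ.* a) ℤ.+ (ℤ.+ 2 ℤ.* b)) - 26)
    ≡⟨ cong (λ s → 1350 * (s - 26)) (ℤ→ℚ-homo-+ (ℤ.+ 5 ℤ.* a) (ℤ.+ 2 ℤ.* b)) ⟩
  1350 * (ℤ→ℚ (ℤ.+ 5 ℤ.* a) + ℤ→ℚ (ℤ.+ 2 ℤ.* b) - 26)
    ≡⟨ cong₂ (λ s s′ → 1350 * (s + s′ - 26))
             (ℤ→ℚ-homo-* (ℤ.+ 5) a) (ℤ→ℚ-homo-* (ℤ.+ 2) b) ⟩
  1350 * (5 * ℤ→ℚ a + 2 * ℤ→ℚ b - 26) ∎

OnE⇒OnCurve : ∀ a b P → OnE a b P → OnCurve (weierstrass (ℤ→ℚ a) (ℤ→ℚ b)) P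
OnE⇒OnCurve a b (X , Y) onE =
  trans onE (cong₂ (λ k₁ k₀ → X * X * X + k₁ * X - k₀)
                   (weierstrass-linear-coeff a) (weierstrass-constant-coeff a b))

β : ℚ → ℚ
β u = 3 / 8 * u * u - 15 / 4 * u - 9 / 8

uCoord : Point → ℚ
uCoord (X , Y) = 1 / 15 * (X - 30)

vCoord : Point → ℚ
vCoord (X , Y) = 2 / 3 * (β (1 / 15 * (X - 30)) - 1 / 30 * Y)

rem₂-onCurve : ∀ A B P → OnCurve (weierstrass A B) P → rem₂ A B (uCoord P) (vCoord P) ≡ 0ℚ
rem₂-onCurve A B (X , Y) onP = factor≡0⇒≡0 (identity A B X Y) onP
  where
  identity : ∀ A B X Y →
    let u  = 1 / 15 * (X - 30)
        v  = 2 / 3 * (3 / 8 * u * u - 15 / 4 * u - 9 / 8 - 1 / 30 * Y)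
        x₂ = 1 / 2 * (1 + 3 * u)
        x₁ = 1 / 2 * (3 * v + 3 * u * u - x₂ * x₂)
        x₀ = 1 / 2 * (A + u * u * u + 6 * u * v - 2 * x₂ * x₁)
    in  x₁ * x₁ + 2 * x₂ * x₀ - 3 * u * u * v - 3 * v * v - B
        ≡ (Y * Y - (X * X * X + 135 * (2 * A - 15) * X - 1350 * (5 * A + 2 * B - 26))) * - (1 / 2700)
  identity = solve-∀ ℚ-ring

rem₁At : ℚ → ℚ → Point → ℚ
rem₁At A C P = rem₁ A C (uCoord P) (vCoord P)

solutionAt : ℚ → ℚ → ℚ → Point → Poly × Poly × Poly
solutionAt A C D P = curveSolution A u v γ (- (rem₀ A D u v * γ))
  where
  u v γ : ℚ
  u = uCoord P
  v = vCoord P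
  γ = inv (rem₁At A C P)

solutionAt-isSolution : ∀ a b c d P → OnCurve (weierstrass (ℤ→ℚ a) (ℤ→ℚ b)) P →
  rem₁At (ℤ→ℚ a) (ℤ→ℚ c) P ≢ 0ℚ →
  IsSolution a b c d (solutionAt (ℤ→ℚ a) (ℤ→ℚ c) (ℤ→ℚ d) P)
solutionAt-isSolution a b c d P onP r₁≢0 =
  residual≈t⇒IsSolution a b c d
    (approxSqrt A u v ∘ₚ linear γ δ) (monicQuadratic u v ∘ₚ linear γ δ) (linear γ δ)
    (residual-curveSolution A B C D u v γ δ (rem₂-onCurve A B P onP) r₁γ≡1 cancel)
  where
  A B C D u v r₀ r₁ γ δ : ℚ
  A = ℤ→ℚ a
  B = ℤ→ℚ b
  C = ℤ→ℚ c
  D = ℤ→ℚ d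
  u = uCoord P
  v = vCoord P
  r₀ = rem₀ A D u v
  r₁ = rem₁ A C u v
  γ = inv r₁
  δ = - (r₀ * γ)
  r₁γ≡1 : r₁ * γ ≡ 1ℚ
  r₁γ≡1 = *-inv r₁ r₁≢0
  regroup : ∀ r₀ r₁ γ → r₀ + r₁ * - (r₀ * γ) ≡ r₀ * (1ℚ - r₁ * γ)
  regroup = solve-∀ ℚ-ring
  cancel : r₀ + r₁ * - (r₀ * γ) ≡ 0ℚ
  cancel = begin
    r₀ + r₁ * - (r₀ * γ) ≡⟨ regroup r₀ r₁ γ ⟩
    r₀ * (1ℚ - r₁ * γ)   ≡⟨ cong (λ s → r₀ * (1ℚ - s)) r₁γ≡1 ⟩
    r₀ * (1ℚ - 1ℚ)       ≡⟨ cong (r₀ *_) (ℚ.+-inverseʳ 1ℚ) ⟩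
    r₀ * 0ℚ              ≡⟨ ℚ.*-zeroʳ r₀ ⟩
    0ℚ                   ∎

-- Inverts (X, Y) ↦ (u, v), given the coefficients c₀, c₁ of
-- y = z² + u z + v when z = δ + γ t.
recoverFrom : ℚ → ℚ → ℚ → ℚ → Point
recoverFrom c₀ c₁ γ δ = 15 * u + 30 , 30 * (β u - 3 / 2 * (c₀ - δ * δ - u * δ))
  where
  u : ℚ
  u = c₁ * inv γ - 2 * δ

recoverPoint : Poly × Poly × Poly → Point
recoverPoint (x , y , z) = recoverFrom (coeff y 0) (coeff y 1) (coeff z 1) (coeff z 0)

recoverPoint-cong : ∀ s s′ → s ≈₃ s′ → recoverPoint s ≡ recoverPoint s′
recoverPoint-cong (x , y , z) (x′ , y′ , z′) (_ , y≈y′ , z≈z′)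
  rewrite z≈z′ 0 | z≈z′ 1 | y≈y′ 0 | y≈y′ 1 = refl

coeff-monicQuadratic-∘ₚ : ∀ u v γ δ →
  coeff (monicQuadratic u v ∘ₚ linear γ δ) 0 ≡ δ * δ + u * δ + v ×
  coeff (monicQuadratic u v ∘ₚ linear γ δ) 1 ≡ γ * (2 * δ + u)
coeff-monicQuadratic-∘ₚ u v γ δ = constant-term u v γ δ , linear-term u γ δ
  where
  constant-term : ∀ u v γ δ → v + (δ * (u + (δ * (1ℚ + 0ℚ) + 0ℚ)) + 0ℚ) ≡ δ * δ + u * δ + v
  constant-term = solve-∀ ℚ-ring
  linear-term : ∀ u γ δ →
    δ * (δ * 0ℚ + (γ * (1ℚ + 0ℚ) + 0ℚ)) + (γ * (u + (δ * (1ℚ + 0ℚ) + 0ℚ)) + 0ℚ)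
      ≡ γ * (2 * δ + u)
  linear-term = solve-∀ ℚ-ring

recoverPoint-curveSolution : ∀ A X Y γ δ → γ ≢ 0ℚ →
  recoverPoint (curveSolution A (uCoord (X , Y)) (vCoord (X , Y)) γ δ) ≡ (X , Y)
recoverPoint-curveSolution A X Y γ δ γ≢0 = begin
  recoverFrom (coeff y 0) (coeff y 1) γ δ
    ≡⟨ cong₂ (λ c₀ c₁ → recoverFrom c₀ c₁ γ δ) (proj₁ coeffs) (proj₂ coeffs) ⟩
  recover (γ * (2 * δ + u) * inv γ - 2 * δ)
    ≡⟨ cong recover (regroup γ (inv γ) δ u) ⟩
  recover (γ * inv γ * (2 * δ + u) - 2 * δ)
    ≡⟨ cong (λ s → recover (s * (2 * δ + u) - 2 * δ)) (*-inv γ γ≢0) ⟩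
  recover (1ℚ * (2 * δ + u) - 2 * δ)
    ≡⟨ cong recover (cancel δ u) ⟩
  recover u
    ≡⟨ cong₂ _,_ (x-coordinate X) (y-coordinate X Y δ) ⟩
  (X , Y) ∎
  where
  u v : ℚ
  u = uCoord (X , Y)
  v = vCoord (X , Y)
  y : Poly
  y = monicQuadratic u v ∘ₚ linear γ δ
  coeffs : coeff y 0 ≡ δ * δ + u * δ + v × coeff y 1 ≡ γ * (2 * δ + u)
  coeffs = coeff-monicQuadratic-∘ₚ u v γ δ
  recover : ℚ → Point
  recover u′ = 15 * u′ + 30 , 30 * (β u′ - 3 / 2 * ((δ * δ + u * δ + v) - δ * δ - u′ * δ))
  regroup : ∀ γ g δ u → γ * (2 * δ + u) * g - 2 * δ ≡ γ * g * (2 * δ + u) - 2 * δ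
  regroup = solve-∀ ℚ-ring
  cancel : ∀ δ u → 1ℚ * (2 * δ + u) - 2 * δ ≡ u
  cancel = solve-∀ ℚ-ring
  x-coordinate : ∀ X → 15 * (1 / 15 * (X - 30)) + 30 ≡ X
  x-coordinate = solve-∀ ℚ-ring
  y-coordinate : ∀ X Y δ →
    let u = 1 / 15 * (X - 30)
        v = 2 / 3 * (3 / 8 * u * u - 15 / 4 * u - 9 / 8 - 1 / 30 * Y)
    in  30 * (3 / 8 * u * u - 15 / 4 * u - 9 / 8 - 3 / 2 * ((δ * δ + u * δ + v) - δ * δ - u * δ)) ≡ Y
  y-coordinate = solve-∀ ℚ-ring

recoverPoint-solutionAt : ∀ A C D P → rem₁At A C P ≢ 0ℚ → recoverPoint (solutionAt A C D P) ≡ P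
recoverPoint-solutionAt A C D (X , Y) r₁≢0 =
  recoverPoint-curveSolution A X Y γ (- (rem₀ A D (uCoord (X , Y)) (vCoord (X , Y)) * γ))
    (inv-≢0 (rem₁At A C (X , Y)) r₁≢0)
  where
  γ : ℚ
  γ = inv (rem₁At A C (X , Y))

-- rem₁ vanishes at few points of the curve

-- rem₁(X, Y) rem₁(X, −Y) reduced modulo Y² − weierstrass(X).
norm : ℚ → ℚ → ℚ → Poly
norm A B C =
  15 / 2 * A * A * A + 3 * A * A * B + 385 / 16 * A * A - 37 / 2 * A * B - 53 / 2 * A * C
    + 4183 / 32 * A + B * B - 2 * B * C + 821 / 8 * B + C * C + 529 / 8 * C - 281759 / 256
  ∷ -3 / 10 * A * A * A - 71 / 15 * A * A + 9 / 10 * A * B + 13 / 15 * A * C - 2641 / 80 * A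
    + 2 / 15 * B * B - 2 / 15 * B * C - 629 / 120 * B + 5 / 6 * C + 14795 / 96
  ∷ 479 / 1800 * A * A + 1 / 450 * A * B + 1 / 150 * A * C + 22337 / 7200 * A + 1 / 225 * B * B
    - 37 / 180 * B - 7 / 20 * C - 14107 / 2880
  ∷ -11 / 2250 * A * A - 1 / 2250 * A * B - 757 / 5400 * A + 41 / 2700 * B + 11 / 1350 * C
    - 6781 / 21600
  ∷ 1 / 90000 * A * A + 1013 / 324000 * A - 1 / 5400 * B + 1 / 81000 * C + 12793 / 432000
  ∷ -71 / 2430000 * A - 1 / 1215000 * B - 931 / 972000
  ∷ 1 / 24300000 * A + 421 / 29160000
  ∷ -19 / 218700000
  ∷ 1 / 26244000000
  ∷ []

rem₁At-norm : ∀ A B C P → OnCurve (weierstrass A B) P →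
  rem₁At A C P * rem₁At A C (neg P) ≡ evalₚ (norm A B C) (proj₁ P)
rem₁At-norm A B C (X , Y) onP = p-q≡0⇒p≡q _ _ (factor≡0⇒≡0 (identity A B C X Y) onP)
  where
  identity : ∀ A B C X Y →
    let u  = 1 / 15 * (X - 30)
        x₂ = 1 / 2 * (1 + 3 * u)
        r₁ = λ (Y : ℚ) →
          let v  = 2 / 3 * (3 / 8 * u * u - 15 / 4 * u - 9 / 8 - 1 / 30 * Y)
              x₁ = 1 / 2 * (3 * v + 3 * u * u - x₂ * x₂)
              x₀ = 1 / 2 * (A + u * u * u + 6 * u * v - 2 * x₂ * x₁)
          in  2 * x₁ * x₀ - 3 * u * v * v - C
        n₀ = 15 / 2 * A * A * A + 3 * A * A * B + 385 / 16 * A * A - 37 / 2 * A * B - 53 / 2 * A * C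
               + 4183 / 32 * A + B * B - 2 * B * C + 821 / 8 * B + C * C + 529 / 8 * C - 281759 / 256
        n₁ = -3 / 10 * A * A * A - 71 / 15 * A * A + 9 / 10 * A * B + 13 / 15 * A * C - 2641 / 80 * A
               + 2 / 15 * B * B - 2 / 15 * B * C - 629 / 120 * B + 5 / 6 * C + 14795 / 96
        n₂ = 479 / 1800 * A * A + 1 / 450 * A * B + 1 / 150 * A * C + 22337 / 7200 * A + 1 / 225 * B * B
               - 37 / 180 * B - 7 / 20 * C - 14107 / 2880
        n₃ = -11 / 2250 * A * A - 1 / 2250 * A * B - 757 / 5400 * A + 41 / 2700 * B + 11 / 1350 * C
               - 6781 / 21600
        n₄ = 1 / 90000 * A * A + 1013 / 324000 * A - 1 / 5400 * B + 1 / 81000 * C + 12793 / 432000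
        n₅ = -71 / 2430000 * A - 1 / 1215000 * B - 931 / 972000
        n₆ = 1 / 24300000 * A + 421 / 29160000
        n₇ = -19 / 218700000
        n₈ = 1 / 26244000000
        w  = X * X * X + 135 * (2 * A - 15) * X - 1350 * (5 * A + 2 * B - 26)
        p  = 1 / 54000 * X * X * X * X - 1 / 270 * X * X * X + 1 / 300 * X * X * A + 1 / 8 * X * X
               - 1 / 2 * X * A - 3 / 10 * X + 43 / 4 * A - C - 321 / 16
        q  = - (1 / 2700) * X * X - 1 / 30 * A + 1 / 4
        r  = - (1 / 40500) * X - 1 / 2700
    in  r₁ Y * r₁ (- Y)
          - (n₀ + X * (n₁ + X * (n₂ + X * (n₃ + X * (n₄ + X * (n₅ + X * (n₆ + X * (n₇ + X * (n₈
              + X * 0ℚ)))))))))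
        ≡ (Y * Y - w) * (r * (2 * p + r * (Y * Y + w)) - q * q)
  identity = solve-∀ ℚ-ring

norm-few-roots : ∀ A B C xs → length xs ≡ 9 → Unique xs →
  All (λ X → evalₚ (norm A B C) X ≡ 0ℚ) xs → ⊥
norm-few-roots A B C xs |xs|≡9 unique roots =
  leading≢0 (roots⇒coeff≡0 (norm A B C) xs (ℕ.≤-reflexive (sym |xs|≡9)) unique roots 8)
  where
  leading≢0 : 1 / 26244000000 ≢ 0ℚ
  leading≢0 ()

rem₁At≢0-or-neg : ∀ A B C P → OnCurve (weierstrass A B) P → evalₚ (norm A B C) (proj₁ P) ≢ 0ℚ →
  rem₁At A C P ≢ 0ℚ ⊎ rem₁At A C (neg P) ≢ 0ℚ
rem₁At≢0-or-neg A B C P onP N≢0 = cases (rem₁At A C P ℚ.≟ 0ℚ)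
  where
  cases : Dec (rem₁At A C P ≡ 0ℚ) → rem₁At A C P ≢ 0ℚ ⊎ rem₁At A C (neg P) ≢ 0ℚ
  cases (no  r₁≢0) = inj₁ r₁≢0
  cases (yes r₁≡0) = inj₂ λ _ → N≢0 (begin
    evalₚ (norm A B C) (proj₁ P)      ≡⟨ sym (rem₁At-norm A B C P onP) ⟩
    rem₁At A C P * rem₁At A C (neg P) ≡⟨ cong (_* rem₁At A C (neg P)) r₁≡0 ⟩
    0ℚ * rem₁At A C (neg P)           ≡⟨ ℚ.*-zeroˡ (rem₁At A C (neg P)) ⟩
    0ℚ                                ∎)

new-solution : ∀ a b c d P (l : List (Poly × Poly × Poly)) →
  OnCurve (weierstrass (ℤ→ℚ a) (ℤ→ℚ b)) P → rem₁At (ℤ→ℚ a) (ℤ→ℚ c) P ≢ 0ℚ →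
  All (P ≢_) (map recoverPoint l) →
  Σ (Poly × Poly × Poly) λ s → IsSolution a b c d s × All (λ s′ → ¬ (s ≈₃ s′)) l
new-solution a b c d P l onP r₁≢0 P∉ =
  s , solutionAt-isSolution a b c d P onP r₁≢0 ,
  All.map (λ {s′} → fresh {s′}) (All.map⁻ {P = P ≢_} {f = recoverPoint} P∉)
  where
  s : Poly × Poly × Poly
  s = solutionAt (ℤ→ℚ a) (ℤ→ℚ c) (ℤ→ℚ d) P
  fresh : ∀ {s′} → P ≢ recoverPoint s′ → ¬ (s ≈₃ s′)
  fresh {s′} P≢ s≈s′ =
    P≢ (trans (sym (recoverPoint-solutionAt (ℤ→ℚ a) (ℤ→ℚ c) (ℤ→ℚ d) P r₁≢0))
              (recoverPoint-cong s s′ s≈s′))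

good-point : ∀ a b c (ex : List Point) → InfinitelyMany _≡_ (OnE a b) →
  Σ Point λ P → OnCurve (weierstrass (ℤ→ℚ a) (ℤ→ℚ b)) P × rem₁At (ℤ→ℚ a) (ℤ→ℚ c) P ≢ 0ℚ
               × All (P ≢_) ex
good-point a b c ex infinite = choose avoiding
  where
  A B C : ℚ
  A = ℤ→ℚ a
  B = ℤ→ℚ b
  C = ℤ→ℚ c
  infinite′ : InfinitelyMany _≡_ (OnCurve (weierstrass A B))
  infinite′ ex′ = let (P , onE , P∉ex′) = infinite ex′ in P , OnE⇒OnCurve a b P onE , P∉ex′
  open Avoiding (weierstrass A B) infinite′ (λ X → evalₚ (norm A B C) X ≡ 0ℚ)
                (λ X → evalₚ (norm A B C) X ℚ.≟ 0ℚ) 9 (norm-few-roots A B C) (ex ++ map neg ex)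
  Good : Set
  Good = Σ Point λ Q → OnCurve (weierstrass A B) Q × rem₁At A C Q ≢ 0ℚ × All (Q ≢_) ex
  pick : ∀ P → OnCurve (weierstrass A B) P → All (P ≢_) ex → All (P ≢_) (map neg ex) →
    rem₁At A C P ≢ 0ℚ ⊎ rem₁At A C (neg P) ≢ 0ℚ → Good
  pick P onP P∉ex P∉-ex (inj₁ r₁≢0) = P , onP , r₁≢0 , P∉ex
  pick P onP P∉ex P∉-ex (inj₂ r₁≢0) = neg P , OnCurve-neg (weierstrass A B) P onP , r₁≢0 ,
    All.map (λ P≢-Q -P≡Q → P≢-Q (trans (sym (neg-involutive P)) (cong neg -P≡Q)))
            (All.map⁻ {P = P ≢_} {f = neg} P∉-ex)
  choose : Wanted → Good
  choose (P , onP , N≢0 , P∉) =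
    let (P∉ex , P∉-ex) = All.++⁻ ex P∉ in pick P onP P∉ex P∉-ex (rem₁At≢0-or-neg A B C P onP N≢0)

corollary1 : (a b c d : ℤ) →
    InfinitelyMany _≡_ (OnE a b) →
    InfinitelyMany _≈₃_ (IsSolution a b c d)
corollary1 a b c d infinite l =
  let (P , onP , r₁≢0 , P∉) = good-point a b c (map recoverPoint l) infinite
  in  new-solution a b c d P l onP r₁≢0 P∉
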